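{- Fix a constant $0\le\varepsilon<2$. For each integer $0\le t\le\varepsilon n$, on the event $Q_t$ we have $\mathbb{E}[M(t+1)-M(t)\mid\mathcal{H}_t]\le(1+n^{ -1/3})\Big(\frac{t}{2n}-\frac{M(t)}{n}\Big)$.
   Context: $G=(L,R,E)$ is the complete bipartite graph with $E=L\times R$, $|L|=|R|=n$, $x_e=1/n$. Vertices are presented in a uniformly random order $v_1,\dots,v_{2n}$; independently each vertex $v$ chooses $F_v$ uniformly among its $n$ neighbours; write $F_i=F_{v_i}$. When $v_i$ is presented, the edge $(v_i,F_i)$ is active if $F_i\in\{v_1,\dots,v_{i-1}\}$, and a deterministic scheme may add it to its matching (if it remains a matching), the decision being a function of $(v_j,F_j)_{j\le i}$. $M(t)$ is the number of matched edges after $t$ vertices are processed; $\mathcal{H}_t$ is the sigma-algebra generated by $(v_i,F_i)_{i=1}^t$. With $V_t=\{v_1,\dots,v_t\}$, $L_t=L\cap V_t$, $R_t=R\cap V_t$, $Q_t$ is the event that $|R\setminus R_t|\le(1+n^{ -1/3})(2n-t)/2$ and $|L\setminus L_t|\le(1+n^{ -1/3})(2n-t)/2$. -}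

module Defs where

open import Data.Bool using (Bool; true; false; _∧_; not)
open import Data.Nat using (ℕ; zero; suc; NonZero) renaming (_+_ to _+ℕ_; _*_ to _*ℕ_; _∸_ to _∸ℕ_)
open import Data.Fin using (Fin)
import Data.Fin.Properties as FinP
open import Data.Sum using (_⊎_; inj₁; inj₂)
open import Data.Sum.Properties using (≡-dec)
open import Data.Product using (_×_; _,_; proj₁; proj₂)
open import Data.List using (List; []; _∷_; _∷ʳ_; map; filter; length; concatMap; allFin; _++_)
open import Data.Nat.ListAction using (sum)
open import Data.List.Relation.Unary.Unique.Propositional using (Unique)
open import Relation.Nullary using (does; ¬?)
open import Relation.Binary using (DecidableEquality)
open import Data.Integer using (ℤ; +_)
open import Data.Rational using (ℚ; _/_; _*_; _-_; _+_; _≤_; 1ℚ)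

-- Vertices of K_{n,n}: L = inj₁ (Fin n), R = inj₂ (Fin n).
Vertex : ℕ → Set
Vertex n = Fin n ⊎ Fin n

_≟V_ : ∀ {n} → DecidableEquality (Vertex n)
_≟V_ = ≡-dec FinP._≟_ FinP._≟_

-- A step (v_i , F_i): the vertex and the index of its chosen neighbour on
-- the other side (every vertex of the other side is a neighbour in K_{n,n}).
Step : ℕ → Set
Step n = Vertex n × Fin n

other : ∀ {n} → Vertex n → Fin n → Vertex n
other (inj₁ _) f = inj₂ f
other (inj₂ _) f = inj₁ f

-- Histories (v_j , F_j)_{j ≤ i}, in chronological order (v_1 first).
History : ℕ → Set
History n = List (Step n)

presented : ∀ {n} → History n → List (Vertex n)
presented h = map proj₁ h

_∈ᵇ_ : ∀ {n} → Vertex n → List (Vertex n) → Bool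
x ∈ᵇ [] = false
x ∈ᵇ (y ∷ ys) with does (x ≟V y)
... | true = true
... | false = x ∈ᵇ ys

-- A deterministic scheme: given the history (v_j , F_j)_{j ≤ i} (including
-- the current step), decide whether to add the edge (v_i , F_i).
Scheme : ℕ → Set
Scheme n = History n → Bool

-- The edge (v , F_v) is added iff it is active (F_v already presented), the
-- scheme says so, and it keeps a matching (both endpoints unmatched).
run : ∀ {n} → Scheme n → History n → List (Vertex n) → ℕ → History n → ℕ
run s done matched m [] = m
run s done matched m ((v , f) ∷ rest) with (other v f ∈ᵇ presented done) ∧ s (done ∷ʳ (v , f)) ∧ not (v ∈ᵇ matched) ∧ not (other v f ∈ᵇ matched)
... | true  = run s (done ∷ʳ (v , f)) (v ∷ other v f ∷ matched) (suc m) rest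
... | false = run s (done ∷ʳ (v , f)) matched m rest

M : ∀ {n} → Scheme n → History n → ℕ
M s h = run s [] [] 0 h

allVertices : (n : ℕ) → List (Vertex n)
allVertices n = map inj₁ (allFin n) ++ map inj₂ (allFin n)

-- Possible next steps (v_{t+1} , F_{t+1}) given the history: v_{t+1} is any
-- not yet presented vertex, F_{t+1} any of its n neighbours; conditionally on
-- H_t these are all equally likely.
nextSteps : ∀ {n} → History n → List (Step n)
nextSteps {n} h =
  concatMap (λ v → map (λ f → (v , f)) (allFin n))
            (filter (λ v → ¬? (Data.List.Membership.DecPropositional._∈?_ _≟V_ v (presented h))) (allVertices n))
  where import Data.List.Membership.DecPropositional

-- Uniform average of a list of naturals (0 for the empty list).
avg : List ℕ → ℚ
avg [] = + 0 / 1
avg (x ∷ xs) = + sum (x ∷ xs) / suc (length xs)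

-- E[ M(t+1) - M(t) | H_t ] evaluated at the history h (of length t).
condExpIncrement : ∀ {n} → Scheme n → History n → ℚ
condExpIncrement s h = avg (map (λ st → M s (h ∷ʳ st) ∸ℕ M s h) (nextSteps h))

countL countR : ∀ {n} → History n → ℕ
countL [] = 0
countL ((inj₁ _ , _) ∷ h) = suc (countL h)
countL ((inj₂ _ , _) ∷ h) = countL h
countR [] = 0
countR ((inj₁ _ , _) ∷ h) = countR h
countR ((inj₂ _ , _) ∷ h) = suc (countR h)

cube : ℚ → ℚ
cube x = x * x * x

-- a ≤ (1 + n^{-1/3}) b, i.e. a - b ≤ n^{-1/3} b, i.e. (cubing, which is
-- strictly increasing on the reals) n (a - b)^3 ≤ b^3.  Exact for all a, b.
LeOnePlusCbrt : ℕ → ℚ → ℚ → Set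
LeOnePlusCbrt n a b = (+ n / 1) * cube (a - b) ≤ cube b

-- The event Q_t for a history h of length t:
-- |R \ R_t| ≤ (1+n^{-1/3})(2n-t)/2 and |L \ L_t| ≤ (1+n^{-1/3})(2n-t)/2.
Q : (n : ℕ) → History n → Set
Q n h = LeOnePlusCbrt n (+ (n ∸ℕ countR h) / 1) ((+ (2 *ℕ n) Data.Integer.- + length h) / 2)
      × LeOnePlusCbrt n (+ (n ∸ℕ countL h) / 1) ((+ (2 *ℕ n) Data.Integer.- + length h) / 2)

-- Histories of positive probability: the presented vertices are distinct.
Valid : ∀ {n} → History n → Set
Valid h = Unique (presented h)

module Submission where

-- Given H_t, the next step (v, F) is uniform over the (a + b)·n pairs with v one of the a left or
-- b right unpresented vertices, a + b = 2n − t. The step raises M by at most 1, and only if F is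
-- presented and unmatched; if X_L, X_R such vertices lie on the two sides, then X_L + X_R ≤ t − 2M,
-- because matched vertices are presented and come in pairs. Summing, the increments total at most
-- a X_R + b X_L ≤ max(a, b) (t − 2M), so the expectation is at most
-- max(a, b) / ((a + b)/2) · (t/(2n) − M/n), and Q_t says max(a, b) ≤ (1 + n^{-1/3}) (a + b)/2.

module FiniteSums where

  open import Data.Bool using (Bool; true; false; not; _∨_)
  open import Data.Fin using (Fin; zero; suc; _≟_)
  open import Data.List using (List; []; _∷_; map; filter; length; concatMap; _++_; allFin)
  import Data.List.Properties as List
  open import Data.Nat hiding (_≟_)
  open import Data.Nat.ListAction using (sum)
  open import Data.Nat.ListAction.Properties using (sum-++)
  open import Data.Nat.Properties hiding (_≟_)
  open import Algebra.Properties.CommutativeSemigroup +-commutativeSemigroup using (interchange)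
  open import Function using (_∘_)
  open import Relation.Binary.PropositionalEquality
  open import Relation.Nullary using (does)
  open import Relation.Unary using (Decidable)

  𝟙 : Bool → ℕ
  𝟙 true = 1
  𝟙 false = 0

  𝟙-not : ∀ b → 𝟙 (not b) + 𝟙 b ≡ 1
  𝟙-not true = refl
  𝟙-not false = refl

  𝟙-∨-disjoint : ∀ a b → (a ≡ true → b ≡ false) → 𝟙 (a ∨ b) ≡ 𝟙 a + 𝟙 b
  𝟙-∨-disjoint true b a⇒¬b rewrite a⇒¬b refl = refl
  𝟙-∨-disjoint false b _ = refl

  ∑ : {A : Set} → List A → (A → ℕ) → ℕ
  ∑ xs f = sum (map f xs)

  module _ {A : Set} where

    ∑-mono-≤ : ∀ (xs : List A) {f g : A → ℕ} → (∀ x → f x ≤ g x) → ∑ xs f ≤ ∑ xs g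
    ∑-mono-≤ [] f≤g = z≤n
    ∑-mono-≤ (x ∷ xs) f≤g = +-mono-≤ (f≤g x) (∑-mono-≤ xs f≤g)

    ∑-cong : ∀ (xs : List A) {f g : A → ℕ} → (∀ x → f x ≡ g x) → ∑ xs f ≡ ∑ xs g
    ∑-cong [] f≡g = refl
    ∑-cong (x ∷ xs) f≡g = cong₂ _+_ (f≡g x) (∑-cong xs f≡g)

    ∑-zero : ∀ (xs : List A) → ∑ xs (λ _ → 0) ≡ 0
    ∑-zero [] = refl
    ∑-zero (x ∷ xs) = ∑-zero xs

    ∑-one : ∀ (xs : List A) → ∑ xs (λ _ → 1) ≡ length xs
    ∑-one [] = refl
    ∑-one (x ∷ xs) = cong suc (∑-one xs)

    ∑-distrib-+ : ∀ (xs : List A) (f g : A → ℕ) → ∑ xs (λ x → f x + g x) ≡ ∑ xs f + ∑ xs g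
    ∑-distrib-+ [] f g = refl
    ∑-distrib-+ (x ∷ xs) f g =
      trans (cong (f x + g x +_) (∑-distrib-+ xs f g)) (interchange (f x) (g x) (∑ xs f) (∑ xs g))

    ∑-*ʳ : ∀ (xs : List A) (f : A → ℕ) k → ∑ xs (λ x → f x * k) ≡ ∑ xs f * k
    ∑-*ʳ [] f k = refl
    ∑-*ʳ (x ∷ xs) f k = trans (cong (f x * k +_) (∑-*ʳ xs f k)) (sym (*-distribʳ-+ k (f x) (∑ xs f)))

    ∑-++ : ∀ (xs ys : List A) (f : A → ℕ) → ∑ (xs ++ ys) f ≡ ∑ xs f + ∑ ys f
    ∑-++ xs ys f = trans (cong sum (List.map-++ f xs ys)) (sum-++ (map f xs) (map f ys))

    ∑-filter : ∀ {P : A → Set} (P? : Decidable P) (xs : List A) (f : A → ℕ) →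
               ∑ (filter P? xs) f ≡ ∑ xs (λ x → 𝟙 (does (P? x)) * f x)
    ∑-filter P? [] f = refl
    ∑-filter P? (x ∷ xs) f with does (P? x)
    ... | true = cong₂ _+_ (sym (+-identityʳ (f x))) (∑-filter P? xs f)
    ... | false = ∑-filter P? xs f

    ∑-map : ∀ {B : Set} (g : B → A) (ys : List B) (f : A → ℕ) → ∑ (map g ys) f ≡ ∑ ys (f ∘ g)
    ∑-map g ys f = cong sum (sym (List.map-∘ ys))

    ∑-concatMap : ∀ {B : Set} (ks : B → List A) (ys : List B) (f : A → ℕ) →
                  ∑ (concatMap ks ys) f ≡ ∑ ys (λ y → ∑ (ks y) f)
    ∑-concatMap ks [] f = refl
    ∑-concatMap ks (y ∷ ys) f =
      trans (∑-++ (ks y) (concatMap ks ys) f) (cong (∑ (ks y) f +_) (∑-concatMap ks ys f))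

  ∑-allFin-suc : ∀ n (f : Fin (suc n) → ℕ) → ∑ (allFin (suc n)) f ≡ f zero + ∑ (allFin n) (f ∘ suc)
  ∑-allFin-suc n f = cong (f zero +_) (trans (cong sum (List.map-tabulate suc f))
                                             (sym (cong sum (List.map-tabulate (λ i → i) (f ∘ suc)))))

  ∑-allFin-one : ∀ n → ∑ (allFin n) (λ _ → 1) ≡ n
  ∑-allFin-one n = trans (∑-one (allFin n)) (List.length-tabulate (λ i → i))

  ∑-allFin-indicator : ∀ n (j : Fin n) → ∑ (allFin n) (λ i → 𝟙 (does (i ≟ j))) ≡ 1
  ∑-allFin-indicator (suc n) zero = trans (∑-allFin-suc n (λ i → 𝟙 (does (i ≟ zero)))) (cong suc (∑-zero (allFin n)))
  ∑-allFin-indicator (suc n) (suc j) = trans (∑-allFin-suc n (λ i → 𝟙 (does (i ≟ suc j)))) (∑-allFin-indicator n j)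

module RationalBounds where

  open import Data.Integer as ℤ using (+_)
  import Data.Integer.Properties as ℤ
  open import Data.Integer.Solver using (module +-*-Solver)
  open import Data.List using (List; []; _∷_; length)
  open import Data.Nat as ℕ using (ℕ; zero; suc)
  import Data.Nat.Properties as ℕ
  open import Data.Nat.Coprimality using (1-coprimeTo) renaming (sym to coprime-sym)
  open import Data.Nat.ListAction using (sum)
  open import Data.Rational
  open import Data.Rational.Properties
  open import Data.Rational.Solver renaming (module +-*-Solver to ℚ-Solver)
  import Data.Rational.Unnormalised as ℚᵘ
  import Data.Rational.Unnormalised.Properties as ℚᵘ
  open import Data.Sum using (inj₁; inj₂)
  open import Defs using (cube; avg; LeOnePlusCbrt)
  open import Relation.Binary.PropositionalEquality

  ι : ℕ → ℚ
  ι a = + a / 1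

  ι≡mkℚ : ∀ a → ι a ≡ mkℚ (+ a) 0 (coprime-sym (1-coprimeTo a))
  ι≡mkℚ a = normalize-coprime (coprime-sym (1-coprimeTo a))

  ι-+ : ∀ a b → ι (a ℕ.+ b) ≡ ι a + ι b
  ι-+ a b rewrite ι≡mkℚ a | ι≡mkℚ b = /-cong {p₁ = + (a ℕ.+ b)} (sym a+b≡) refl
    where a+b≡ : + a ℤ.* + 1 ℤ.+ + b ℤ.* + 1 ≡ + (a ℕ.+ b)
          a+b≡ = trans (cong₂ ℤ._+_ (ℤ.*-identityʳ (+ a)) (ℤ.*-identityʳ (+ b))) (sym (ℤ.pos-+ a b))

  ι-* : ∀ a b → ι (a ℕ.* b) ≡ ι a * ι b
  ι-* a b rewrite ι≡mkℚ a | ι≡mkℚ b = /-cong {p₁ = + (a ℕ.* b)} (ℤ.pos-* a b) refl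

  ι-mono-≤ : ∀ {a b} → a ℕ.≤ b → ι a ≤ ι b
  ι-mono-≤ {a} {b} a≤b rewrite ι≡mkℚ a | ι≡mkℚ b =
    *≤* (subst₂ ℤ._≤_ (sym (ℤ.*-identityʳ (+ a))) (sym (ℤ.*-identityʳ (+ b))) (ℤ.+≤+ a≤b))

  ι-nonNeg : ∀ a → 0ℚ ≤ ι a
  ι-nonNeg a = ι-mono-≤ {0} {a} ℕ.z≤n

  /-*-ι : ∀ a q .{{_ : ℕ.NonZero q}} → (+ a / q) * ι q ≡ ι a
  /-*-ι a q rewrite ι≡mkℚ q | ι≡mkℚ a =
    toℚᵘ-injective (ℚᵘ.≃-trans (toℚᵘ-homo-* x q̂) (ℚᵘ.*≡* (cross x (↥-/ (+ a) q) (↧-/ (+ a) q))))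
    where
    open +-*-Solver
    x = + a / q
    q̂ = mkℚ (+ q) 0 (coprime-sym (1-coprimeTo q))
    cross : ∀ (x : ℚ) {g} → ↥ x ℤ.* g ≡ + a → ↧ x ℤ.* g ≡ + q →
            ℚᵘ.↥ (toℚᵘ x ℚᵘ.* toℚᵘ q̂) ℤ.* + 1 ≡ + a ℤ.* ℚᵘ.↧ (toℚᵘ x ℚᵘ.* toℚᵘ q̂)
    cross x@(mkℚ _ _ _) {g} ↥x*g≡a ↧x*g≡q = begin
      (↥ x ℤ.* + q) ℤ.* + 1         ≡⟨ cong (λ z → (↥ x ℤ.* z) ℤ.* + 1) (sym ↧x*g≡q) ⟩
      (↥ x ℤ.* (↧ x ℤ.* g)) ℤ.* + 1 ≡⟨ solve 3 (λ u d g → (u :* (d :* g)) :* con (+ 1) := (u :* g) :* (d :* con (+ 1))) refl (↥ x) (↧ x) g ⟩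
      (↥ x ℤ.* g) ℤ.* (↧ x ℤ.* + 1) ≡⟨ cong (ℤ._* (↧ x ℤ.* + 1)) ↥x*g≡a ⟩
      + a ℤ.* (↧ x ℤ.* + 1)         ∎
      where open ≡-Reasoning

  *-mono-≤-nonNeg : ∀ {a b c d} → 0ℚ ≤ a → 0ℚ ≤ d → a ≤ b → c ≤ d → a * c ≤ b * d
  *-mono-≤-nonNeg {a} {b} {c} {d} 0≤a 0≤d a≤b c≤d = ≤-trans
    (*-monoˡ-≤-nonNeg a {{nonNegative 0≤a}} c≤d) (*-monoʳ-≤-nonNeg d {{nonNegative 0≤d}} a≤b)

  square-nonNeg : ∀ {d} → 0ℚ ≤ d → 0ℚ ≤ d * d
  square-nonNeg {d} 0≤d = nonNegative⁻¹ (d * d) {{nonNeg*nonNeg⇒nonNeg d d}}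
    where instance d≥0 = nonNegative 0≤d

  cube-nonNeg : ∀ {d} → 0ℚ ≤ d → 0ℚ ≤ cube d
  cube-nonNeg {d} 0≤d = nonNegative⁻¹ (d * d * d)
    {{nonNeg*nonNeg⇒nonNeg (d * d) {{nonNegative (square-nonNeg 0≤d)}} d {{nonNegative 0≤d}}}}

  cube-nonPos : ∀ {d} → d ≤ 0ℚ → cube d ≤ 0ℚ
  cube-nonPos {d} d≤0 = nonPositive⁻¹ (d * d * d)
    {{nonNeg*nonPos⇒nonPos (d * d) {{nonPos*nonPos⇒nonPos d d}} d}}
    where instance d≤0′ = nonPositive d≤0

  cube-mono-≤ : ∀ {x y} → 0ℚ ≤ x → x ≤ y → cube x ≤ cube y
  cube-mono-≤ {x} {y} 0≤x x≤y =
    *-mono-≤-nonNeg (square-nonNeg 0≤x) 0≤y (*-mono-≤-nonNeg 0≤x 0≤y x≤y x≤y) x≤y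
    where 0≤y = ≤-trans 0≤x x≤y

  cube-* : ∀ x y → cube (x * y) ≡ cube x * cube y
  cube-* = solve 2 (λ x y → ((x :* y) :* (x :* y)) :* (x :* y) := ((x :* x) :* x) :* ((y :* y) :* y)) refl
    where open ℚ-Solver

  LeOnePlusCbrt-nonPos : ∀ n {E B} → 0ℚ ≤ B → E - B ≤ 0ℚ → LeOnePlusCbrt n E B
  LeOnePlusCbrt-nonPos n {E} {B} 0≤B E-B≤0 = ≤-trans
    (nonPositive⁻¹ _ {{nonNeg*nonPos⇒nonPos (ι n) {{nonNegative (ι-nonNeg n)}} (cube (E - B)) {{nonPositive (cube-nonPos E-B≤0)}}}})
    (cube-nonNeg 0≤B)

  LeOnePlusCbrt-transfer : ∀ n {E B c b} → 0ℚ < b → 0ℚ ≤ B → E * b ≤ c * B →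
                           LeOnePlusCbrt n c b → LeOnePlusCbrt n E B
  LeOnePlusCbrt-transfer n {E} {B} {c} {b} 0<b 0≤B Eb≤cB c≤b with ≤-total (E - B) 0ℚ
  ... | inj₁ E-B≤0 = LeOnePlusCbrt-nonPos n {E} 0≤B E-B≤0
  ... | inj₂ 0≤E-B = *-cancelʳ-≤-pos (cube b) {{cube-pos}} (begin
    ι n * cube (E - B) * cube b   ≡⟨ trans (*-assoc (ι n) _ _) (cong (ι n *_) (sym (cube-* (E - B) b))) ⟩
    ι n * cube ((E - B) * b)      ≤⟨ *-monoˡ-≤-nonNeg (ι n) {{nonNegative (ι-nonNeg n)}} (cube-mono-≤ 0≤[E-B]b [E-B]b≤[c-b]B) ⟩
    ι n * cube ((c - b) * B)      ≡⟨ trans (cong (ι n *_) (cube-* (c - b) B)) (sym (*-assoc (ι n) _ _)) ⟩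
    ι n * cube (c - b) * cube B   ≤⟨ *-monoʳ-≤-nonNeg (cube B) {{nonNegative (cube-nonNeg 0≤B)}} c≤b ⟩
    cube b * cube B               ≡⟨ *-comm (cube b) (cube B) ⟩
    cube B * cube b               ∎)
    where
    open ≤-Reasoning
    0≤[E-B]b : 0ℚ ≤ (E - B) * b
    0≤[E-B]b = nonNegative⁻¹ _ {{nonNeg*nonNeg⇒nonNeg (E - B) {{nonNegative 0≤E-B}} b {{nonNegative (<⇒≤ 0<b)}}}}
    cube-pos : Positive (cube b)
    cube-pos = pos*pos⇒pos (b * b) {{pos*pos⇒pos b b}} b
      where instance b>0 = positive 0<b
    *-distribʳ-- : ∀ x y z → (x - y) * z ≡ x * z - y * z
    *-distribʳ-- = solve 3 (λ x y z → (x :- y) :* z := x :* z :- y :* z) refl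
      where open ℚ-Solver
    [E-B]b≤[c-b]B : (E - B) * b ≤ (c - b) * B
    [E-B]b≤[c-b]B = begin
      (E - B) * b    ≡⟨ *-distribʳ-- E B b ⟩
      E * b - B * b  ≤⟨ +-mono-≤ Eb≤cB (≤-reflexive (cong -_ (*-comm B b))) ⟩
      c * B - b * B  ≡⟨ sym (*-distribʳ-- c b B) ⟩
      (c - b) * B    ∎

  [+m+n]-[+m]≡+n : ∀ t p → + (t ℕ.+ p) ℤ.- + t ≡ + p
  [+m+n]-[+m]≡+n t p = trans (ℤ.[+m]-[+n]≡m⊖n (t ℕ.+ p) t)
                           (trans (ℤ.⊖-≥ (ℕ.m≤m+n t p)) (cong +_ (ℕ.m+n∸m≡n t p)))

  -- k = t − 2m counts the presented vertices left unmatched.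
  t/2n-m/n*2n≡k : ∀ n t m k .{{_ : ℕ.NonZero n}} → k ℕ.+ 2 ℕ.* m ≡ t →
                   ((+ t / n) * ½ - (+ m / n)) * (ι 2 * ι n) ≡ ι k
  t/2n-m/n*2n≡k n t m k k+2m≡t = begin
    (τ * ½ - μ) * (ι 2 * ι n)        ≡⟨ solve 3 (λ τ μ ν → ((τ :* con ½) :- μ) :* (con (ι 2) :* ν) := τ :* ν :- con (ι 2) :* (μ :* ν)) refl τ μ (ι n) ⟩
    τ * ι n - ι 2 * (μ * ι n)        ≡⟨ cong₂ (λ x y → x - ι 2 * y) (/-*-ι t n) (/-*-ι m n) ⟩
    ι t - ι 2 * ι m                  ≡⟨ cong (λ z → ι z - ι 2 * ι m) (sym k+2m≡t) ⟩
    ι (k ℕ.+ 2 ℕ.* m) - ι 2 * ι m    ≡⟨ cong (_- ι 2 * ι m) (trans (ι-+ k (2 ℕ.* m)) (cong (λ z → ι k + z) (ι-* 2 m))) ⟩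
    (ι k + ι 2 * ι m) - ι 2 * ι m    ≡⟨ solve 2 (λ k m → (k :+ con (ι 2) :* m) :- con (ι 2) :* m := k) refl (ι k) (ι m) ⟩
    ι k                              ∎
    where
    open ≡-Reasoning
    open ℚ-Solver
    τ = + t / n
    μ = + m / n

  2n-pos : ∀ n .{{_ : ℕ.NonZero n}} → Positive (ι 2 * ι n)
  2n-pos n = pos*pos⇒pos (ι 2) (ι n) {{normalize-pos n 1}}

  t/2n-m/n≥0 : ∀ n t m k .{{_ : ℕ.NonZero n}} → k ℕ.+ 2 ℕ.* m ≡ t →
                     0ℚ ≤ (+ t / n) * ½ - (+ m / n)
  t/2n-m/n≥0 n t m k k+2m≡t = *-cancelʳ-≤-pos (ι 2 * ι n) {{2n-pos n}}
    (subst₂ _≤_ (sym (*-zeroˡ (ι 2 * ι n))) (sym (t/2n-m/n*2n≡k n t m k k+2m≡t)) (ι-nonNeg k))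

  avg-LeOnePlusCbrt : ∀ n t m k c p .{{_ : ℕ.NonZero n}} (xs : List ℕ) →
    length xs ≡ p ℕ.* n → sum xs ℕ.≤ c ℕ.* k → k ℕ.+ 2 ℕ.* m ≡ t → 2 ℕ.* n ≡ t ℕ.+ p →
    LeOnePlusCbrt n (ι c) ((+ (2 ℕ.* n) ℤ.- + t) / 2) →
    LeOnePlusCbrt n (avg xs) ((+ t / n) * ½ - (+ m / n))
  avg-LeOnePlusCbrt n t m k c p [] _ _ k+2m≡t _ _ = LeOnePlusCbrt-nonPos n {avg []} 0≤B
    (≤-trans (≤-reflexive (+-identityˡ _)) (neg-antimono-≤ 0≤B))
    where 0≤B = t/2n-m/n≥0 n t m k k+2m≡t
  avg-LeOnePlusCbrt n t m k c zero (x ∷ xs) ()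
  avg-LeOnePlusCbrt n t m k c (suc p) xs@(_ ∷ _) length≡ sum≤ k+2m≡t 2n≡t+p c≤b =
    LeOnePlusCbrt-transfer n {E} {B} {ι c} {b} (positive⁻¹ b {{normalize-pos (suc p) 2}})
      (t/2n-m/n≥0 n t m k k+2m≡t) Eb≤cB (subst (λ z → LeOnePlusCbrt n (ι c) z) b≡ c≤b)
    where
    b = + suc p / 2
    B = (+ t / n) * ½ - (+ m / n)
    E = avg xs
    b≡ : (+ (2 ℕ.* n) ℤ.- + t) / 2 ≡ b
    b≡ = cong (_/ 2) (trans (cong (λ a → + a ℤ.- + t) 2n≡t+p) ([+m+n]-[+m]≡+n t (suc p)))
    Ebw≡ : E * b * (ι 2 * ι n) ≡ ι (sum xs)
    Ebw≡ = begin
      E * b * (ι 2 * ι n)     ≡⟨ solve 4 (λ E b x y → E :* b :* (x :* y) := E :* ((b :* x) :* y)) refl E b (ι 2) (ι n) ⟩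
      E * ((b * ι 2) * ι n)   ≡⟨ cong (λ z → E * (z * ι n)) (/-*-ι (suc p) 2) ⟩
      E * (ι (suc p) * ι n)   ≡⟨ cong (E *_) (sym (ι-* (suc p) n)) ⟩
      E * ι (suc p ℕ.* n)     ≡⟨ cong (λ z → E * ι z) (sym length≡) ⟩
      E * ι (length xs)       ≡⟨ /-*-ι (sum xs) (length xs) ⟩
      ι (sum xs)              ∎
      where
      open ≡-Reasoning
      open ℚ-Solver
    cBw≡ : ι c * B * (ι 2 * ι n) ≡ ι (c ℕ.* k)
    cBw≡ = trans (*-assoc (ι c) B _) (trans (cong (ι c *_) (t/2n-m/n*2n≡k n t m k k+2m≡t)) (sym (ι-* c k)))
    Eb≤cB : E * b ≤ ι c * B
    Eb≤cB = *-cancelʳ-≤-pos (ι 2 * ι n) {{2n-pos n}} (subst₂ _≤_ (sym Ebw≡) (sym cBw≡) (ι-mono-≤ sum≤))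

module Replay where

  open import Data.Bool using (Bool; true; false; _∧_; _∨_; not)
  open import Data.Bool.Properties using (∨-assoc; ∨-identityʳ)
  open import Data.List using (List; []; _∷_; _∷ʳ_; map; length; _++_; allFin) renaming ([_] to [_]ᴸ)
  import Data.List.Properties as List
  open import Data.Nat
  open import Data.Nat.Properties
  open import Data.Nat.Solver using (module +-*-Solver)
  open import Data.Product using (_,_; proj₁)
  open import Data.Sum using (inj₁; inj₂)
  open import Defs
  open import Function using (_∘_)
  open import Relation.Binary.PropositionalEquality
  open import Relation.Nullary using (does; yes; no; contradiction)
  open FiniteSums

  module _ {n : ℕ} where

    _≟ᵇ_ : Vertex n → Vertex n → Bool
    u ≟ᵇ v = does (u ≟V v)

    ≟ᵇ⇒≡ : ∀ {u v} → u ≟ᵇ v ≡ true → u ≡ v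
    ≟ᵇ⇒≡ {u} {v} eq with u ≟V v
    ... | yes u≡v = u≡v
    ≟ᵇ⇒≡ () | no _

    ∈ᵇ-∷ : ∀ u y ys → u ∈ᵇ (y ∷ ys) ≡ u ≟ᵇ y ∨ u ∈ᵇ ys
    ∈ᵇ-∷ u y ys with does (u ≟V y)
    ... | true = refl
    ... | false = refl

    ∈ᵇ-++ : ∀ u xs ys → u ∈ᵇ (xs ++ ys) ≡ u ∈ᵇ xs ∨ u ∈ᵇ ys
    ∈ᵇ-++ u [] ys = refl
    ∈ᵇ-++ u (x ∷ xs) ys rewrite ∈ᵇ-∷ u x (xs ++ ys) | ∈ᵇ-∷ u x xs | ∈ᵇ-++ u xs ys =
      sym (∨-assoc (u ≟ᵇ x) (u ∈ᵇ xs) (u ∈ᵇ ys))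

    ∈ᵇ-presented-∷ʳ : ∀ u (d : History n) v f → u ∈ᵇ presented (d ∷ʳ (v , f)) ≡ u ∈ᵇ presented d ∨ u ≟ᵇ v
    ∈ᵇ-presented-∷ʳ u d v f rewrite List.map-++ proj₁ d [ v , f ]ᴸ | ∈ᵇ-++ u (presented d) [ v ]ᴸ | ∈ᵇ-∷ u v [] =
      cong (u ∈ᵇ presented d ∨_) (∨-identityʳ (u ≟ᵇ v))

    ∑-vertices : ∀ (g : Vertex n → ℕ) → ∑ (allVertices n) g ≡ ∑ (allFin n) (g ∘ inj₁) + ∑ (allFin n) (g ∘ inj₂)
    ∑-vertices g = trans (∑-++ (map inj₁ (allFin n)) (map inj₂ (allFin n)) g)
                         (cong₂ _+_ (∑-map inj₁ (allFin n) g) (∑-map inj₂ (allFin n) g))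

    ∑-vertices-indicator : ∀ v → ∑ (allVertices n) (λ u → 𝟙 (u ≟ᵇ v)) ≡ 1
    ∑-vertices-indicator (inj₁ j) = trans (∑-vertices _) (cong₂ _+_ (∑-allFin-indicator n j) (∑-zero (allFin n)))
    ∑-vertices-indicator (inj₂ j) = trans (∑-vertices _) (cong₂ _+_ (∑-zero (allFin n)) (∑-allFin-indicator n j))

  𝟙-∨-∧ : ∀ a e c → 𝟙 ((a ∨ e) ∧ c) ≤ 𝟙 (a ∧ c) + 𝟙 e
  𝟙-∨-∧ true e c = m≤m+n (𝟙 c) (𝟙 e)
  𝟙-∨-∧ false true true = ≤-refl
  𝟙-∨-∧ false true false = z≤n
  𝟙-∨-∧ false false c = z≤n

  𝟙-∨-∧-not : ∀ a e m → 𝟙 ((a ∨ e) ∧ not (e ∨ m)) ≤ 𝟙 (a ∧ not m)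
  𝟙-∨-∧-not true true m = z≤n
  𝟙-∨-∧-not false true m = z≤n
  𝟙-∨-∧-not true false m = ≤-refl
  𝟙-∨-∧-not false false m = z≤n

  𝟙-∧-not-∨ : ∀ a e m → (e ≡ true → a ∧ not m ≡ true) → 𝟙 (a ∧ not (e ∨ m)) + 𝟙 e ≤ 𝟙 (a ∧ not m)
  𝟙-∧-not-∨ true true m e⇒ rewrite e⇒ refl = ≤-refl
  𝟙-∧-not-∨ false true m e⇒ = contradiction (e⇒ refl) λ ()
  𝟙-∧-not-∨ a false m _ = ≤-reflexive (+-identityʳ _)

  ∧-drop-middle : ∀ a b c e → a ∧ b ∧ c ∧ e ≡ true → a ∧ e ≡ true
  ∧-drop-middle true true true e eq = eq
  ∧-drop-middle true true false e ()
  ∧-drop-middle true false c e ()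
  ∧-drop-middle false b c e ()


  length-∷ʳ : ∀ {A : Set} (xs : List A) {x} → length (xs ∷ʳ x) ≡ suc (length xs)
  length-∷ʳ xs = trans (List.length-++ xs) (+-comm (length xs) 1)

  module _ {n : ℕ} where

    available : History n → List (Vertex n) → Vertex n → Bool
    available done matched u = (u ∈ᵇ presented done) ∧ not (u ∈ᵇ matched)

    #available : History n → List (Vertex n) → ℕ
    #available done matched = ∑ (allVertices n) (𝟙 ∘ available done matched)

    accepts : Scheme n → History n → List (Vertex n) → Step n → Bool
    accepts s done matched (v , f) =
      (other v f ∈ᵇ presented done) ∧ s (done ∷ʳ (v , f)) ∧ not (v ∈ᵇ matched) ∧ not (other v f ∈ᵇ matched)

    accepts⇒available : ∀ s done matched v f → accepts s done matched (v , f) ≡ true →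
                        available done matched (other v f) ≡ true
    accepts⇒available s done matched v f =
      ∧-drop-middle (other v f ∈ᵇ presented done) (s (done ∷ʳ (v , f))) (not (v ∈ᵇ matched)) (not (other v f ∈ᵇ matched))

    #available-skip : ∀ done matched v f → #available (done ∷ʳ (v , f)) matched ≤ #available done matched + 1
    #available-skip done matched v f = begin
      #available (done ∷ʳ (v , f)) matched
        ≤⟨ ∑-mono-≤ (allVertices n) (λ u → subst (λ z → 𝟙 (z ∧ not (u ∈ᵇ matched)) ≤ _)
                                                  (sym (∈ᵇ-presented-∷ʳ u done v f))
                                                  (𝟙-∨-∧ (u ∈ᵇ presented done) (u ≟ᵇ v) (not (u ∈ᵇ matched)))) ⟩
      ∑ (allVertices n) (λ u → 𝟙 (available done matched u) + 𝟙 (u ≟ᵇ v))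
        ≡⟨ ∑-distrib-+ (allVertices n) _ _ ⟩
      #available done matched + ∑ (allVertices n) (λ u → 𝟙 (u ≟ᵇ v))
        ≡⟨ cong (#available done matched +_) (∑-vertices-indicator v) ⟩
      #available done matched + 1 ∎
      where open ≤-Reasoning

    #available-match : ∀ done matched v f → available done matched (other v f) ≡ true →
                       #available (done ∷ʳ (v , f)) (v ∷ other v f ∷ matched) + 1 ≤ #available done matched
    #available-match done matched v f w-available = begin
      #available (done ∷ʳ (v , f)) (v ∷ w ∷ matched) + 1
        ≡⟨ cong (#available (done ∷ʳ (v , f)) (v ∷ w ∷ matched) +_) (sym (∑-vertices-indicator w)) ⟩
      #available (done ∷ʳ (v , f)) (v ∷ w ∷ matched) + ∑ (allVertices n) (λ u → 𝟙 (u ≟ᵇ w))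
        ≡⟨ sym (∑-distrib-+ (allVertices n) _ _) ⟩
      ∑ (allVertices n) (λ u → 𝟙 (available (done ∷ʳ (v , f)) (v ∷ w ∷ matched) u) + 𝟙 (u ≟ᵇ w))
        ≤⟨ ∑-mono-≤ (allVertices n) (λ u → ≤-trans (+-monoˡ-≤ (𝟙 (u ≟ᵇ w)) (drop-v u)) (drop-w u)) ⟩
      #available done matched ∎
      where
      open ≤-Reasoning
      w = other v f
      drop-v : ∀ u → 𝟙 (available (done ∷ʳ (v , f)) (v ∷ w ∷ matched) u) ≤ 𝟙 (available done (w ∷ matched) u)
      drop-v u rewrite ∈ᵇ-presented-∷ʳ u done v f | ∈ᵇ-∷ u v (w ∷ matched) =
        𝟙-∨-∧-not (u ∈ᵇ presented done) (u ≟ᵇ v) (u ∈ᵇ (w ∷ matched))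
      drop-w : ∀ u → 𝟙 (available done (w ∷ matched) u) + 𝟙 (u ≟ᵇ w) ≤ 𝟙 (available done matched u)
      drop-w u rewrite ∈ᵇ-∷ u w matched = 𝟙-∧-not-∨ (u ∈ᵇ presented done) (u ≟ᵇ w) (u ∈ᵇ matched)
        (λ u≟w → subst (λ z → available done matched z ≡ true) (sym (≟ᵇ⇒≡ u≟w)) w-available)

    record State : Set where
      constructor state
      field
        done : History n
        matched : List (Vertex n)
        size : ℕ

    replay : Scheme n → State → History n → State
    replay s st [] = st
    replay s (state d ma m) ((v , f) ∷ rest) with accepts s d ma (v , f)
    ... | true = replay s (state (d ∷ʳ (v , f)) (v ∷ other v f ∷ ma) (suc m)) rest
    ... | false = replay s (state (d ∷ʳ (v , f)) ma m) rest

    resume : Scheme n → State → History n → ℕ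
    resume s (state d ma m) = run s d ma m

    run-++ : ∀ s d ma m xs ys → run s d ma m (xs ++ ys) ≡ resume s (replay s (state d ma m) xs) ys
    run-++ s d ma m [] ys = refl
    run-++ s d ma m ((v , f) ∷ xs) ys with accepts s d ma (v , f)
    ... | true = run-++ s (d ∷ʳ (v , f)) (v ∷ other v f ∷ ma) (suc m) xs ys
    ... | false = run-++ s (d ∷ʳ (v , f)) ma m xs ys

    replay-done : ∀ s d ma m xs → State.done (replay s (state d ma m) xs) ≡ d ++ xs
    replay-done s d ma m [] = sym (List.++-identityʳ d)
    replay-done s d ma m ((v , f) ∷ xs) with accepts s d ma (v , f)
    ... | true = trans (replay-done s (d ∷ʳ (v , f)) (v ∷ other v f ∷ ma) (suc m) xs) (List.++-assoc d _ xs)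
    ... | false = trans (replay-done s (d ∷ʳ (v , f)) ma m xs) (List.++-assoc d _ xs)

    Invariant : State → Set
    Invariant (state d ma m) = #available d ma + 2 * m ≤ length d

    Invariant-skip : ∀ d ma m v f → Invariant (state d ma m) → Invariant (state (d ∷ʳ (v , f)) ma m)
    Invariant-skip d ma m v f inv = begin
      #available (d ∷ʳ (v , f)) ma + 2 * m  ≤⟨ +-monoˡ-≤ (2 * m) (#available-skip d ma v f) ⟩
      #available d ma + 1 + 2 * m           ≡⟨ trans (+-assoc (#available d ma) 1 (2 * m)) (+-suc (#available d ma) (2 * m)) ⟩
      suc (#available d ma + 2 * m)         ≤⟨ s≤s inv ⟩
      suc (length d)                        ≡⟨ sym (length-∷ʳ d) ⟩
      length (d ∷ʳ (v , f))                 ∎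
      where open ≤-Reasoning

    Invariant-match : ∀ d ma m v f → available d ma (other v f) ≡ true →
                      Invariant (state d ma m) → Invariant (state (d ∷ʳ (v , f)) (v ∷ other v f ∷ ma) (suc m))
    Invariant-match d ma m v f w-available inv = begin
      a + 2 * suc m          ≡⟨ solve 2 (λ a m → a :+ con 2 :* (con 1 :+ m) := con 1 :+ ((a :+ con 1) :+ con 2 :* m)) refl a m ⟩
      suc (a + 1 + 2 * m)    ≤⟨ s≤s (+-monoˡ-≤ (2 * m) (#available-match d ma v f w-available)) ⟩
      suc (#available d ma + 2 * m) ≤⟨ s≤s inv ⟩
      suc (length d)         ≡⟨ sym (length-∷ʳ d) ⟩
      length (d ∷ʳ (v , f))  ∎
      where
      open ≤-Reasoning
      open +-*-Solver
      a = #available (d ∷ʳ (v , f)) (v ∷ other v f ∷ ma)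

    replay-invariant : ∀ s st xs → Invariant st → Invariant (replay s st xs)
    replay-invariant s st [] inv = inv
    replay-invariant s (state d ma m) ((v , f) ∷ xs) inv with accepts s d ma (v , f) in accepted
    ... | true = replay-invariant s _ xs (Invariant-match d ma m v f (accepts⇒available s d ma v f accepted) inv)
    ... | false = replay-invariant s _ xs (Invariant-skip d ma m v f inv)

    increment-≤ : ∀ s d ma m v f → run s d ma m [ v , f ]ᴸ ∸ m ≤ 𝟙 (available d ma (other v f))
    increment-≤ s d ma m v f with accepts s d ma (v , f) in accepted
    ... | true rewrite m+n∸n≡m 1 m | accepts⇒available s d ma v f accepted = ≤-refl
    ... | false rewrite n∸n≡0 m = z≤n

module NextSteps where

  open import Data.Bool using (Bool; false; not; _∨_)
  open import Data.Empty using (⊥-elim)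
  open import Data.Fin using (Fin)
  open import Data.List using (List; []; _∷_; _∷ʳ_; map; filter; length; allFin) renaming ([_] to [_]ᴸ)
  import Data.List.Membership.DecPropositional as Membership
  import Data.List.Properties as List
  open import Data.List.Relation.Unary.All using (All; []; _∷_)
  open import Data.List.Relation.Unary.AllPairs using ([]; _∷_)
  open import Data.List.Relation.Unary.Unique.Propositional using (Unique)
  open import Data.Nat hiding (_/_)
  open import Data.Nat.Properties
  open import Data.Nat.Solver using (module +-*-Solver)
  import Data.Integer as ℤ
  open import Data.Product using (_,_; uncurry)
  open import Data.Rational using (ℚ; _/_)
  open import Data.Sum using (inj₁; inj₂)
  open import Defs
  open import Function using (_∘_)
  open import Relation.Binary.PropositionalEquality
  open import Relation.Nullary using (does; yes; no; ¬_; ¬?)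
  open FiniteSums
  open Replay
  open RationalBounds using (ι)

  module _ {n : ℕ} where

    ∈?≡∈ᵇ : ∀ (v : Vertex n) P → does (Membership._∈?_ _≟V_ v P) ≡ v ∈ᵇ P
    ∈?≡∈ᵇ v [] = refl
    ∈?≡∈ᵇ v (y ∷ ys) = trans (cong (v ≟ᵇ y ∨_) (∈?≡∈ᵇ v ys)) (sym (∈ᵇ-∷ v y ys))

    ∉⇒∈ᵇ≡false : ∀ {v : Vertex n} {P} → All (λ y → ¬ v ≡ y) P → v ∈ᵇ P ≡ false
    ∉⇒∈ᵇ≡false {v} {[]} [] = refl
    ∉⇒∈ᵇ≡false {v} {y ∷ P} (v≢y ∷ v∉P) with v ≟V y
    ... | yes v≡y = ⊥-elim (v≢y v≡y)
    ... | no _ = ∉⇒∈ᵇ≡false v∉P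

    ∑-∈ᵇ-unique : ∀ {A : Set} (σ : A → Vertex n) (U : List A) P → Unique P →
                  ∑ U (λ a → 𝟙 (σ a ∈ᵇ P)) ≡ ∑ P (λ v → ∑ U (λ a → 𝟙 (σ a ≟ᵇ v)))
    ∑-∈ᵇ-unique σ U [] [] = ∑-zero U
    ∑-∈ᵇ-unique σ U (v ∷ P) (v∉P ∷ unique) = begin
      ∑ U (λ a → 𝟙 (σ a ∈ᵇ (v ∷ P)))                             ≡⟨ ∑-cong U split ⟩
      ∑ U (λ a → 𝟙 (σ a ≟ᵇ v) + 𝟙 (σ a ∈ᵇ P))                    ≡⟨ ∑-distrib-+ U _ _ ⟩
      ∑ U (λ a → 𝟙 (σ a ≟ᵇ v)) + ∑ U (λ a → 𝟙 (σ a ∈ᵇ P))         ≡⟨ cong (∑ U (λ a → 𝟙 (σ a ≟ᵇ v)) +_) (∑-∈ᵇ-unique σ U P unique) ⟩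
      ∑ (v ∷ P) (λ w → ∑ U (λ a → 𝟙 (σ a ≟ᵇ w)))                 ∎
      where
      open ≡-Reasoning
      split : ∀ a → 𝟙 (σ a ∈ᵇ (v ∷ P)) ≡ 𝟙 (σ a ≟ᵇ v) + 𝟙 (σ a ∈ᵇ P)
      split a = trans (cong 𝟙 (∈ᵇ-∷ (σ a) v P))
                      (𝟙-∨-disjoint _ _ (λ σa≟v → subst (λ u → u ∈ᵇ P ≡ false) (sym (≟ᵇ⇒≡ σa≟v)) (∉⇒∈ᵇ≡false v∉P)))

    countL≡∑ : ∀ (h : History n) → countL h ≡ ∑ (presented h) (λ v → ∑ (allFin n) (λ i → 𝟙 (inj₁ i ≟ᵇ v)))
    countL≡∑ [] = refl
    countL≡∑ ((inj₁ j , _) ∷ h) = cong₂ _+_ (sym (∑-allFin-indicator n j)) (countL≡∑ h)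
    countL≡∑ ((inj₂ j , _) ∷ h) = cong₂ _+_ (sym (∑-zero (allFin n))) (countL≡∑ h)

    countR≡∑ : ∀ (h : History n) → countR h ≡ ∑ (presented h) (λ v → ∑ (allFin n) (λ i → 𝟙 (inj₂ i ≟ᵇ v)))
    countR≡∑ [] = refl
    countR≡∑ ((inj₁ j , _) ∷ h) = cong₂ _+_ (sym (∑-zero (allFin n))) (countR≡∑ h)
    countR≡∑ ((inj₂ j , _) ∷ h) = cong₂ _+_ (sym (∑-allFin-indicator n j)) (countR≡∑ h)

    +≡⇒≡∸ : ∀ {a c} → a + c ≡ n → a ≡ n ∸ c
    +≡⇒≡∸ {a} {c} a+c≡n = trans (sym (m+n∸n≡m a c)) (cong (_∸ c) a+c≡n)

    length≡countL+countR : ∀ (h : History n) → length h ≡ countL h + countR h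
    length≡countL+countR [] = refl
    length≡countL+countR ((inj₁ _ , _) ∷ h) = cong suc (length≡countL+countR h)
    length≡countL+countR ((inj₂ _ , _) ∷ h) = trans (cong suc (length≡countL+countR h)) (sym (+-suc (countL h) (countR h)))

  module _ {n : ℕ} (h : History n) where

    unpresented : Vertex n → ℕ
    unpresented v = 𝟙 (not (v ∈ᵇ presented h))

    #unpresentedL #unpresentedR : ℕ
    #unpresentedL = ∑ (allFin n) (unpresented ∘ inj₁)
    #unpresentedR = ∑ (allFin n) (unpresented ∘ inj₂)

    ∑-allFin-unpresented : ∀ (σ : Fin n → Vertex n) →
      ∑ (allFin n) (unpresented ∘ σ) + ∑ (allFin n) (λ i → 𝟙 (σ i ∈ᵇ presented h)) ≡ n
    ∑-allFin-unpresented σ = begin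
      ∑ (allFin n) (unpresented ∘ σ) + ∑ (allFin n) (λ i → 𝟙 (σ i ∈ᵇ presented h))
        ≡⟨ sym (∑-distrib-+ (allFin n) _ _) ⟩
      ∑ (allFin n) (λ i → unpresented (σ i) + 𝟙 (σ i ∈ᵇ presented h))
        ≡⟨ ∑-cong (allFin n) (λ i → 𝟙-not (σ i ∈ᵇ presented h)) ⟩
      ∑ (allFin n) (λ _ → 1)
        ≡⟨ ∑-allFin-one n ⟩
      n ∎
      where open ≡-Reasoning

    #unpresentedL+countL≡n : Valid h → #unpresentedL + countL h ≡ n
    #unpresentedL+countL≡n valid = trans
      (cong (#unpresentedL +_) (trans (countL≡∑ h) (sym (∑-∈ᵇ-unique inj₁ (allFin n) (presented h) valid))))
      (∑-allFin-unpresented inj₁)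

    #unpresentedR+countR≡n : Valid h → #unpresentedR + countR h ≡ n
    #unpresentedR+countR≡n valid = trans
      (cong (#unpresentedR +_) (trans (countR≡∑ h) (sym (∑-∈ᵇ-unique inj₂ (allFin n) (presented h) valid))))
      (∑-allFin-unpresented inj₂)

    ∑-nextSteps : ∀ (k : Step n → ℕ) →
      ∑ (nextSteps h) k ≡ ∑ (allVertices n) (λ v → unpresented v * ∑ (allFin n) (λ f → k (v , f)))
    ∑-nextSteps k = begin
      ∑ (nextSteps h) k
        ≡⟨ ∑-concatMap (λ v → map (v ,_) (allFin n)) (filter unpresented? (allVertices n)) k ⟩
      ∑ (filter unpresented? (allVertices n)) (λ v → ∑ (map (v ,_) (allFin n)) k)
        ≡⟨ ∑-filter unpresented? (allVertices n) _ ⟩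
      ∑ (allVertices n) (λ v → 𝟙 (does (unpresented? v)) * ∑ (map (v ,_) (allFin n)) k)
        ≡⟨ ∑-cong (allVertices n) (λ v → cong₂ _*_ (cong (𝟙 ∘ not) (∈?≡∈ᵇ v (presented h))) (∑-map (v ,_) (allFin n) k)) ⟩
      ∑ (allVertices n) (λ v → unpresented v * ∑ (allFin n) (λ f → k (v , f))) ∎
      where
      open ≡-Reasoning
      unpresented? = λ v → ¬? (Membership._∈?_ _≟V_ v (presented h))

    ∑-nextSteps-other : ∀ (g : Vertex n → ℕ) →
      ∑ (nextSteps h) (g ∘ uncurry other) ≡ #unpresentedL * ∑ (allFin n) (g ∘ inj₂) + #unpresentedR * ∑ (allFin n) (g ∘ inj₁)
    ∑-nextSteps-other g =
      trans (∑-nextSteps (g ∘ uncurry other))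
            (trans (∑-vertices (λ v → unpresented v * ∑ (allFin n) (λ f → g (other v f))))
                   (cong₂ _+_ (∑-*ʳ (allFin n) (unpresented ∘ inj₁) _) (∑-*ʳ (allFin n) (unpresented ∘ inj₂) _)))

    length-nextSteps : length (nextSteps h) ≡ (#unpresentedL + #unpresentedR) * n
    length-nextSteps = begin
      length (nextSteps h)                                ≡⟨ sym (∑-one (nextSteps h)) ⟩
      ∑ (nextSteps h) (λ _ → 1)                           ≡⟨ ∑-nextSteps-other (λ _ → 1) ⟩
      #unpresentedL * ∑ (allFin n) (λ _ → 1) + #unpresentedR * ∑ (allFin n) (λ _ → 1)
                                                          ≡⟨ cong (λ z → #unpresentedL * z + #unpresentedR * z) (∑-allFin-one n) ⟩
      #unpresentedL * n + #unpresentedR * n               ≡⟨ sym (*-distribʳ-+ n #unpresentedL #unpresentedR) ⟩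
      (#unpresentedL + #unpresentedR) * n                 ∎
      where open ≡-Reasoning

    2n≡length+#unpresented : Valid h → 2 * n ≡ length h + (#unpresentedL + #unpresentedR)
    2n≡length+#unpresented valid = begin
      2 * n                                  ≡⟨ cong (n +_) (+-identityʳ n) ⟩
      n + n                                  ≡⟨ cong₂ _+_ (sym (#unpresentedL+countL≡n valid)) (sym (#unpresentedR+countR≡n valid)) ⟩
      (#unpresentedL + countL h) + (#unpresentedR + countR h)
                                             ≡⟨ solve 4 (λ a b c d → (a :+ b) :+ (c :+ d) := (b :+ d) :+ (a :+ c)) refl #unpresentedL (countL h) #unpresentedR (countR h) ⟩
      (countL h + countR h) + (#unpresentedL + #unpresentedR)
                                             ≡⟨ cong (_+ (#unpresentedL + #unpresentedR)) (sym (length≡countL+countR h)) ⟩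
      length h + (#unpresentedL + #unpresentedR) ∎
      where
      open ≡-Reasoning
      open +-*-Solver

    remaining/2 : ℚ
    remaining/2 = (ℤ.+ (2 * n) ℤ.- ℤ.+ length h) / 2

    #unpresented⊔-LeOnePlusCbrt : Valid h → Q n h → LeOnePlusCbrt n (ι (#unpresentedL ⊔ #unpresentedR)) remaining/2
    #unpresented⊔-LeOnePlusCbrt valid (R-bound , L-bound) with ⊔-sel #unpresentedL #unpresentedR
    ... | inj₁ ⊔≡L = subst (λ c → LeOnePlusCbrt n (ι c) remaining/2)
      (sym (trans ⊔≡L (+≡⇒≡∸ (#unpresentedL+countL≡n valid)))) L-bound
    ... | inj₂ ⊔≡R = subst (λ c → LeOnePlusCbrt n (ι c) remaining/2)
      (sym (trans ⊔≡R (+≡⇒≡∸ (#unpresentedR+countR≡n valid)))) R-bound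

  module _ {n : ℕ} (s : Scheme n) (h : History n) where

    private
      final : State
      final = replay s (state [] [] 0) h

      availableAfter : Vertex n → Bool
      availableAfter = available (State.done final) (State.matched final)

    increment : Step n → ℕ
    increment st = M s (h ∷ʳ st) ∸ M s h

    M≡size : M s h ≡ State.size final
    M≡size = trans (cong (run s [] [] 0) (sym (List.++-identityʳ h))) (run-++ s [] [] 0 h [])

    increment-≤-available : ∀ v f → increment (v , f) ≤ 𝟙 (availableAfter (other v f))
    increment-≤-available v f rewrite run-++ s [] [] 0 h [ v , f ]ᴸ | M≡size =
      increment-≤ s (State.done final) (State.matched final) (State.size final) v f

    available+2M≤length : #available (State.done final) (State.matched final) + 2 * M s h ≤ length h
    available+2M≤length rewrite M≡size = ≤-trans
      (replay-invariant s (state [] [] 0) h (≤-reflexive (trans (+-identityʳ _) (∑-zero (allVertices n)))))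
      (≤-reflexive (cong length (replay-done s [] [] 0 h)))

    2M≤length : 2 * M s h ≤ length h
    2M≤length = ≤-trans (m≤n+m (2 * M s h) (#available (State.done final) (State.matched final))) available+2M≤length

    ∑-increments-≤ : ∑ (nextSteps h) increment ≤ (#unpresentedL h ⊔ #unpresentedR h) * (length h ∸ 2 * M s h)
    ∑-increments-≤ = begin
      ∑ (nextSteps h) increment
        ≤⟨ ∑-mono-≤ (nextSteps h) {g = 𝟙 ∘ availableAfter ∘ uncurry other} (λ (v , f) → increment-≤-available v f) ⟩
      ∑ (nextSteps h) (𝟙 ∘ availableAfter ∘ uncurry other)
        ≡⟨ ∑-nextSteps-other h (𝟙 ∘ availableAfter) ⟩
      #unpresentedL h * XR + #unpresentedR h * XL
        ≤⟨ +-mono-≤ (*-monoˡ-≤ XR (m≤m⊔n (#unpresentedL h) (#unpresentedR h))) (*-monoˡ-≤ XL (m≤n⊔m (#unpresentedL h) (#unpresentedR h))) ⟩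
      c * XR + c * XL
        ≡⟨ sym (*-distribˡ-+ c XR XL) ⟩
      c * (XR + XL)
        ≤⟨ *-monoʳ-≤ c (m+n≤o⇒m≤o∸n (XR + XL) XR+XL+2M≤length) ⟩
      c * (length h ∸ 2 * M s h) ∎
      where
      open ≤-Reasoning
      XL = ∑ (allFin n) (𝟙 ∘ availableAfter ∘ inj₁)
      XR = ∑ (allFin n) (𝟙 ∘ availableAfter ∘ inj₂)
      c = #unpresentedL h ⊔ #unpresentedR h
      XR+XL+2M≤length : XR + XL + 2 * M s h ≤ length h
      XR+XL+2M≤length = subst (λ x → x + 2 * M s h ≤ length h)
        (trans (∑-vertices (𝟙 ∘ availableAfter)) (+-comm XL XR)) available+2M≤length

open import Defs
open import Data.Nat using (ℕ; NonZero)
open import Data.List using (length; map)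
open import Data.Integer using (+_)
open import Data.Rational using (ℚ; _/_; _*_; _-_; _≤_; _<_; ½)
import Data.List.Properties as List
import Data.Nat as ℕ
open import Data.Nat.Properties using (m∸n+n≡m)
open import Relation.Binary.PropositionalEquality using (trans)
open RationalBounds using (avg-LeOnePlusCbrt)
open NextSteps

lemma12 : (ε : ℚ) → (+ 0 / 1) ≤ ε → ε < (+ 2 / 1)
    → (n : ℕ) → .{{_ : NonZero n}}
    → (s : Scheme n) (h : History n) → Valid h
    → (+ length h / 1) ≤ ε * (+ n / 1)
    → Q n h
    → LeOnePlusCbrt n (condExpIncrement s h) (((+ length h / n) * ½) - (+ M s h / n))
lemma12 ε _ _ n s h valid _ q =
  avg-LeOnePlusCbrt n (length h) (M s h) (length h ℕ.∸ 2 ℕ.* M s h) (#unpresentedL h ℕ.⊔ #unpresentedR h)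
    (#unpresentedL h ℕ.+ #unpresentedR h) (map (increment s h) (nextSteps h))
    (trans (List.length-map (increment s h) (nextSteps h)) (length-nextSteps h))
    (∑-increments-≤ s h)
    (m∸n+n≡m (2M≤length s h))
    (2n≡length+#unpresented h valid)
    (#unpresented⊔-LeOnePlusCbrt h valid q)
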